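{- Let $T$ be a balanced complete binary tree of height $h$ with root $s$, in which all leaves are identified into a single vertex $t$. Consider the Minimum Shared Edges instance $(T,s,t,p,k)$ with $p\ge h+3$ and $k\le h$. Then in every solution the set of shared edges is exactly the edge set of a complete path from $s$ to some (former) leaf; in particular, a solution can exist only if $k=h$.
   Context: Minimum Shared Edges: given a graph $G$, distinct vertices $s,t$ and integers $k,p$, a solution is a multiset of $p$ $s$-$t$ paths such that at most $k$ edges lie in at least two of the paths (these are the shared edges). -}

module Defs where

open import Level using (0ℓ)
open import Data.Bool using (Bool)
open import Data.Nat using (ℕ; zero; suc; _+_; _≤_; _<_; _<?_)
open import Data.List using (List; []; _∷_; _++_; length)
open import Data.List.Membership.Propositional using (_∈_)
open import Data.List.Relation.Unary.Unique.Propositional using (Unique)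
open import Data.Fin using (Fin)
open import Data.Product using (Σ; ∃; _×_; _,_)
open import Data.Sum using (_⊎_)
open import Relation.Nullary using (¬_; yes; no)
open import Relation.Binary.PropositionalEquality using (_≡_)

record Multigraph : Set₁ where
  field
    Vertex : Set
    Edge   : Set
    ends   : Edge → Vertex × Vertex

module _ (G : Multigraph) where
  open Multigraph G

  Joins : Edge → Vertex → Vertex → Set
  Joins e u w = (ends e ≡ (u , w)) ⊎ (ends e ≡ (w , u))

  data Walk : Vertex → Vertex → Set where
    []   : ∀ {u} → Walk u u
    step : ∀ {u w v} (e : Edge) → Joins e u w → Walk w v → Walk u v

  walkVertices : ∀ {u v} → Walk u v → List Vertex
  walkVertices {u} []            = u ∷ []
  walkVertices {u} (step e _ ws) = u ∷ walkVertices ws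

  walkEdges : ∀ {u v} → Walk u v → List Edge
  walkEdges []            = []
  walkEdges (step e _ ws) = e ∷ walkEdges ws

  Path : Vertex → Vertex → Set
  Path u v = Σ (Walk u v) λ W → Unique (walkVertices W)

  pathEdges : ∀ {u v} → Path u v → List Edge
  pathEdges (W , _) = walkEdges W

  -- For a multiset of p paths (indexed by Fin p), edge e is shared if it
  -- lies in at least two of the paths (two different indices).
  Shared : ∀ {s t p} → (Fin p → Path s t) → Edge → Set
  Shared P e = ∃ λ i → ∃ λ j → ¬ (i ≡ j) × e ∈ pathEdges (P i) × e ∈ pathEdges (P j)

  AtMostShared : ∀ {s t p} → (Fin p → Path s t) → ℕ → Set
  AtMostShared P k = ∃ λ (L : List Edge) → length L ≤ k × (∀ e → Shared P e → e ∈ L)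

  MSESolution : Vertex → Vertex → ℕ → ℕ → Set
  MSESolution s t p k = Σ (Fin p → Path s t) λ P → AtMostShared P k

-- A tree node is encoded by its list of left/right choices from the
-- root, MOST RECENT CHOICE FIRST (so the parent of b ∷ w is w).
-- Nodes of depth < h are kept; all nodes of depth h (the leaves) become t.

data TVertex (h : ℕ) : Set where
  node : (w : List Bool) → .(length w < h) → TVertex h
  t    : TVertex h

data TEdge (h : ℕ) : Set where
  edge : (b : Bool) (w : List Bool) → .(length w < h) → TEdge h

childVertex : ∀ {h} → (b : Bool) (w : List Bool) → TVertex h
childVertex {h} b w with length (b ∷ w) <? h
... | yes q = node (b ∷ w) q
... | no _  = t

tEnds : ∀ {h} → TEdge h → TVertex h × TVertex h
tEnds (edge b w q) = node w q , childVertex b w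

TreeLeaves : ℕ → Multigraph
TreeLeaves h = record { Vertex = TVertex h ; Edge = TEdge h ; ends = tEnds }

root : ∀ {h} → .(1 ≤ h) → TVertex h
root h≥1 = node [] h≥1

-- edge e lies on the root-to-leaf path of T ending at leaf ℓ
-- (ℓ a list of h choices, most recent first): its lower endpoint b ∷ w
-- is an ancestor-or-self of ℓ, i.e. a suffix of ℓ.
OnBranch : ∀ {h} → List Bool → TEdge h → Set
OnBranch ℓ (edge b w _) = ∃ λ u → u ++ (b ∷ w) ≡ ℓ

module Submission where

-- Every s–t path runs from the root down to one leaf and then stops at t, so a
-- solution is a family of p leaves, and an edge is shared iff two of the paths
-- have their leaves below it.  If the p leaves were pairwise distinct, a subtree
-- holding m ≥ 2 of them would contain at least m − 1 shared edges (the edge into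
-- it plus those of its two child subtrees), forcing p ≤ 2 + k ≤ h + 2.  Hence two
-- paths end at the same leaf ℓ and all h edges of the branch to ℓ are shared; as
-- at most k ≤ h edges are shared, k = h and the shared edges are exactly this branch.

open import Defs
open import Data.Bool using (Bool; true; false)
open import Data.Bool.Properties using () renaming (_≟_ to _≟ᴮ_)
open import Data.Nat using (ℕ; zero; suc; _+_; _∸_; _≤_; _≥_; _<_; _<?_; _≤?_; z≤n; s≤s)
open import Data.Nat.Properties
  using (≤-refl; ≤-reflexive; <-irrefl; ≤-trans; ≤-antisym; ≤-pred; <⇒≤; ≮⇒≥; ≰⇒>; m≤n⇒m≤1+n;
         +-identityʳ; +-suc; +-comm; +-mono-≤; +-monoʳ-≤; m<m+n; m+[n∸m]≡n; module ≤-Reasoning)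
open import Data.List using (List; []; _∷_; _++_; length; lookup)
open import Data.List.Properties using (≡-dec; length-++)
open import Data.List.Membership.Propositional using (_∈_; _∉_)
open import Data.List.Membership.Propositional.Properties using (∈-lookup)
open import Data.List.Relation.Unary.All as All using (All; []; _∷_)
open import Data.List.Relation.Unary.All.Properties using () renaming (++⁺ to All-++⁺)
open import Data.List.Relation.Unary.AllPairs using ([]; _∷_)
open import Data.List.Relation.Unary.Any using (here; there; index)
open import Data.List.Relation.Unary.Any.Properties using (lookup-index)
open import Data.List.Relation.Unary.Unique.Propositional using (Unique)
open import Data.List.Relation.Unary.Unique.Propositional.Properties using (++⁺)
open import Data.Fin using (Fin; zero; suc)
open import Data.Fin.Properties using (injective⇒≤; suc-injective; any?) renaming (_≟_ to _≟ᶠ_)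
open import Data.Product using (Σ; ∃; ∃₂; _×_; _,_; proj₁; proj₂; map₂)
open import Data.Sum using (_⊎_; inj₁; inj₂)
open import Data.Empty using (⊥-elim)
open import Function using (_∘_; case_of_)
open import Function.Bundles using (_⇔_; mk⇔; Equivalence)
open import Relation.Nullary using (¬_; Dec; yes; no)
open import Relation.Nullary.Decidable using (recompute; decidable-stable; ¬?; _×-dec_; _⊎-dec_)
open import Relation.Binary.Definitions using (DecidableEquality)
open import Relation.Binary.PropositionalEquality

open Equivalence

module _ {A : Set} where

  lookup-injective : ∀ {xs : List A} → Unique xs → ∀ i j → lookup xs i ≡ lookup xs j → i ≡ j
  lookup-injective (_ ∷ _) zero zero _ = refl
  lookup-injective (x∉ ∷ _) zero (suc j) eq = ⊥-elim (All.lookup x∉ (∈-lookup j) eq)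
  lookup-injective (x∉ ∷ _) (suc i) zero eq = ⊥-elim (All.lookup x∉ (∈-lookup i) (sym eq))
  lookup-injective (_ ∷ u) (suc i) (suc j) eq = cong suc (lookup-injective u i j eq)

  Unique-⊆⇒length≤ : ∀ {xs ys : List A} → Unique xs → (∀ {x} → x ∈ xs → x ∈ ys) →
    length xs ≤ length ys
  Unique-⊆⇒length≤ {xs} {ys} u xs⊆ys = injective⇒≤ {f = position} position-injective
    where
    position : Fin (length xs) → Fin (length ys)
    position i = index (xs⊆ys (∈-lookup i))
    position-injective : ∀ {i j} → position i ≡ position j → i ≡ j
    position-injective {i} {j} eq = lookup-injective u i j (begin
      lookup xs i             ≡⟨ lookup-index (xs⊆ys (∈-lookup i)) ⟩
      lookup ys (position i)  ≡⟨ cong (lookup ys) eq ⟩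
      lookup ys (position j)  ≡⟨ sym (lookup-index (xs⊆ys (∈-lookup j))) ⟩
      lookup xs j             ∎)
      where open ≡-Reasoning

  2+length-++ : ∀ (xs ys : List A) → suc (length xs) + suc (length ys) ≡ 2 + length (xs ++ ys)
  2+length-++ xs ys = cong suc (trans (+-suc (length xs) (length ys)) (cong suc (sym (length-++ xs))))

  -- xs ⊑ ys: xs is a suffix of ys.  With the encoding of tree nodes in Defs,
  -- node xs is then an ancestor-or-self of node ys.
  infix 4 _⊑_
  data _⊑_ (xs : List A) : List A → Set where
    ⊑-refl : xs ⊑ xs
    ⊑-step : ∀ {y ys} → xs ⊑ ys → xs ⊑ y ∷ ys

  ⊑-length : ∀ {xs ys} → xs ⊑ ys → length xs ≤ length ys
  ⊑-length ⊑-refl = ≤-refl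
  ⊑-length (⊑-step s) = m≤n⇒m≤1+n (⊑-length s)

  []⊑ : ∀ ys → [] ⊑ ys
  []⊑ [] = ⊑-refl
  []⊑ (y ∷ ys) = ⊑-step ([]⊑ ys)

  ⊑-trans : ∀ {xs ys zs} → xs ⊑ ys → ys ⊑ zs → xs ⊑ zs
  ⊑-trans s ⊑-refl = s
  ⊑-trans s (⊑-step s′) = ⊑-step (⊑-trans s s′)

  ⊑-tail : ∀ {x xs ys} → x ∷ xs ⊑ ys → xs ⊑ ys
  ⊑-tail = ⊑-trans (⊑-step ⊑-refl)

  ∷⊑∷⇒⊑ : ∀ {x xs y ys} → x ∷ xs ⊑ y ∷ ys → xs ⊑ ys
  ∷⊑∷⇒⊑ ⊑-refl = ⊑-refl
  ∷⊑∷⇒⊑ (⊑-step s) = ⊑-tail s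

  ∷⋢ : ∀ {x xs} → ¬ (x ∷ xs ⊑ xs)
  ∷⋢ s = <-irrefl refl (⊑-length s)

  ⊑-length-≡ : ∀ {xs ys} → xs ⊑ ys → length xs ≡ length ys → xs ≡ ys
  ⊑-length-≡ ⊑-refl _ = refl
  ⊑-length-≡ (⊑-step {ys = ys} s) eq = ⊥-elim (<-irrefl refl (subst (_≤ length ys) eq (⊑-length s)))

  ⊑-functional : ∀ {xs ys zs} → xs ⊑ zs → ys ⊑ zs → length xs ≡ length ys → xs ≡ ys
  ⊑-functional ⊑-refl s′ eq = sym (⊑-length-≡ s′ (sym eq))
  ⊑-functional (⊑-step s) ⊑-refl eq = ⊑-length-≡ (⊑-step s) eq
  ⊑-functional (⊑-step s) (⊑-step s′) eq = ⊑-functional s s′ eq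

  ⊑-proper : ∀ {xs ys} → xs ⊑ ys → ys ≡ xs ⊎ ∃ λ x → x ∷ xs ⊑ ys
  ⊑-proper ⊑-refl = inj₁ refl
  ⊑-proper (⊑-step {y} s) with ⊑-proper s
  ... | inj₁ refl = inj₂ (y , ⊑-refl)
  ... | inj₂ (x , s′) = inj₂ (x , ⊑-step s′)

  ⊑⇒++ : ∀ {xs ys} → xs ⊑ ys → ∃ λ us → us ++ xs ≡ ys
  ⊑⇒++ ⊑-refl = [] , refl
  ⊑⇒++ (⊑-step {y} s) with us , refl ← ⊑⇒++ s = y ∷ us , refl

  ++⇒⊑ : ∀ {xs ys} → (∃ λ us → us ++ xs ≡ ys) → xs ⊑ ys
  ++⇒⊑ ([] , refl) = ⊑-refl
  ++⇒⊑ (u ∷ us , refl) = ⊑-step (++⇒⊑ (us , refl))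

  module ⊑-Decidable (_≟_ : DecidableEquality A) where

    _⊑?_ : ∀ xs ys → Dec (xs ⊑ ys)
    xs ⊑? ys with ≡-dec _≟_ xs ys
    ... | yes refl = yes ⊑-refl
    xs ⊑? [] | no xs≢[] = no λ { ⊑-refl → xs≢[] refl }
    xs ⊑? (y ∷ ys) | no xs≢ with xs ⊑? ys
    ... | yes s = yes (⊑-step s)
    ... | no ¬s = no λ { ⊑-refl → xs≢ refl ; (⊑-step s) → ¬s s }

count : ∀ {p} {P : Fin p → Set} → (∀ i → Dec (P i)) → ℕ
count {zero} P? = 0
count {suc p} P? with P? zero
... | yes _ = suc (count (λ i → P? (suc i)))
... | no _ = count (λ i → P? (suc i))

count-universal : ∀ {p} {P : Fin p → Set} (P? : ∀ i → Dec (P i)) → (∀ i → P i) → count P? ≡ p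
count-universal {zero} P? all = refl
count-universal {suc p} P? all with P? zero
... | yes _ = cong suc (count-universal (λ i → P? (suc i)) (λ i → all (suc i)))
... | no ¬P0 = ⊥-elim (¬P0 (all zero))

count-cong : ∀ {p} {P Q : Fin p → Set} (P? : ∀ i → Dec (P i)) (Q? : ∀ i → Dec (Q i)) →
  (∀ i → P i ⇔ Q i) → count P? ≡ count Q?
count-cong {zero} P? Q? P⇔Q = refl
count-cong {suc p} P? Q? P⇔Q with P? zero | Q? zero
  | count-cong (λ i → P? (suc i)) (λ i → Q? (suc i)) (λ i → P⇔Q (suc i))
... | yes _  | yes _  | ih = cong suc ih
... | no _   | no _   | ih = ih
... | yes P0 | no ¬Q0 | _  = ⊥-elim (¬Q0 (to (P⇔Q zero) P0))
... | no ¬P0 | yes Q0 | _  = ⊥-elim (¬P0 (from (P⇔Q zero) Q0))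

count-⊎ : ∀ {p} {P Q : Fin p → Set} (P? : ∀ i → Dec (P i)) (Q? : ∀ i → Dec (Q i)) →
  (∀ i → P i → ¬ Q i) → count (λ i → P? i ⊎-dec Q? i) ≡ count P? + count Q?
count-⊎ {zero} P? Q? disjoint = refl
count-⊎ {suc p} P? Q? disjoint with P? zero | Q? zero
  | count-⊎ (λ i → P? (suc i)) (λ i → Q? (suc i)) (λ i → disjoint (suc i))
... | yes P0 | yes Q0 | _  = ⊥-elim (disjoint zero P0 Q0)
... | yes _  | no _   | ih = cong suc ih
... | no _   | yes _  | ih = trans (cong suc ih) (sym (+-suc _ _))
... | no _   | no _   | ih = ih

count-witness : ∀ {p} {P : Fin p → Set} (P? : ∀ i → Dec (P i)) → 1 ≤ count P? → ∃ P
count-witness {suc p} P? pos with P? zero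
... | yes P0 = zero , P0
... | no _ with i , Pi ← count-witness (λ i → P? (suc i)) pos = suc i , Pi

count-two-witnesses : ∀ {p} {P : Fin p → Set} (P? : ∀ i → Dec (P i)) → 2 ≤ count P? →
  ∃₂ λ i j → i ≢ j × P i × P j
count-two-witnesses {suc p} P? two with P? zero
count-two-witnesses {suc p} P? (s≤s one) | yes P0
  with i , Pi ← count-witness (λ i → P? (suc i)) one = zero , suc i , (λ ()) , P0 , Pi
... | no _ with i , j , i≢j , Pi , Pj ← count-two-witnesses (λ i → P? (suc i)) two =
  suc i , suc j , (λ eq → i≢j (suc-injective eq)) , Pi , Pj

open ⊑-Decidable _≟ᴮ_ using (_⊑?_)

module _ {h : ℕ} where

  lower upper : TEdge h → List Bool
  lower (edge b w _) = b ∷ w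
  upper (edge _ w _) = w

  OnBranch⇔⊑ : ∀ ℓ e → OnBranch ℓ e ⇔ lower e ⊑ ℓ
  OnBranch⇔⊑ ℓ (edge b w _) = mk⇔ ++⇒⊑ ⊑⇒++

  lower⋢upper : ∀ e → ¬ lower e ⊑ upper e
  lower⋢upper (edge _ _ _) = ∷⋢

  ∷⊑lower⇒⊑upper : ∀ {b v} e → b ∷ v ⊑ lower e → v ⊑ upper e
  ∷⊑lower⇒⊑upper (edge _ _ _) = ∷⊑∷⇒⊑

  upper⊑lower : ∀ e → upper e ⊑ lower e
  upper⊑lower (edge _ _ _) = ⊑-step ⊑-refl

  ⊑-edge-cases : ∀ {ℓ b w} .(q : length w < h) → b ∷ w ⊑ ℓ → ∀ e → lower e ⊑ ℓ → w ⊑ upper e →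
    e ≡ edge b w q ⊎ b ∷ w ⊑ upper e
  ⊑-edge-cases q bw⊑ℓ (edge c v _) cv⊑ℓ w⊑v with ⊑-proper w⊑v
  ... | inj₁ refl with ⊑-functional cv⊑ℓ bw⊑ℓ refl
  ...   | refl = inj₁ refl
  ⊑-edge-cases q bw⊑ℓ (edge c v _) cv⊑ℓ w⊑v | inj₂ (a , aw⊑v)
    with ⊑-functional (⊑-trans aw⊑v (⊑-tail cv⊑ℓ)) bw⊑ℓ refl
  ...   | refl = inj₂ aw⊑v

  private
    G : Multigraph
    G = TreeLeaves h

  childVertex-cases : ∀ b w → (Σ (length (b ∷ w) < h) λ q → childVertex b w ≡ node (b ∷ w) q)
                              ⊎ (¬ length (b ∷ w) < h × childVertex {h} b w ≡ t)
  childVertex-cases b w with length (b ∷ w) <? h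
  ... | yes q = inj₁ (q , refl)
  ... | no ¬q = inj₂ (¬q , refl)

  childVertex≡node : ∀ {b v w} .{q} → childVertex {h} b v ≡ node w q → w ≡ b ∷ v
  childVertex≡node {b} {v} eq with childVertex-cases b v
  ... | inj₁ (_ , eq′) with trans (sym eq′) eq
  ...   | refl = refl
  childVertex≡node {b} {v} eq | inj₂ (_ , eq′) with trans (sym eq′) eq
  ...   | ()

  head∈walkVertices : ∀ {x y} (W : Walk G x y) → x ∈ walkVertices G W
  head∈walkVertices [] = here refl
  head∈walkVertices (step _ _ _) = here refl

  last∈walkVertices : ∀ {x y} (W : Walk G x y) → y ∈ walkVertices G W
  last∈walkVertices [] = here refl
  last∈walkVertices (step _ _ W) = there (last∈walkVertices W)

  path-from-t : ∀ {x} → x ≡ t → (W : Walk G x t) → Unique (walkVertices G W) → walkEdges G W ≡ []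
  path-from-t refl [] _ = refl
  path-from-t refl (step _ _ W) (t∉W ∷ _) = ⊥-elim (All.lookup t∉W (last∈walkVertices W) refl)

  -- Since the walk avoids the parent of w it can only step down; once it reaches t it must stop.
  descend : ∀ {x} w .(q : length w < h) → x ≡ node w q → (W : Walk G x t) → Unique (walkVertices G W) →
    (∀ {b v} .(q′ : length v < h) → w ≡ b ∷ v → node v q′ ∉ walkVertices G W) →
    ∃ λ ℓ → length ℓ ≡ h × w ⊑ ℓ × (∀ e → e ∈ walkEdges G W ⇔ (lower e ⊑ ℓ × w ⊑ upper e))
  descend w q refl (step (edge b v q′) (inj₂ ends≡) W) _ parent∉W =
    ⊥-elim (parent∉W q′ (childVertex≡node (cong proj₂ ends≡))
      (there (subst (_∈ walkVertices G W) (sym (cong proj₁ ends≡)) (head∈walkVertices W))))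
  descend w q refl (step (edge b w q′) (inj₁ refl) W) (w∉W ∷ uW) _ with childVertex-cases b w
  ... | inj₂ (¬q , child≡t) = b ∷ w , leaf-depth , ⊑-step ⊑-refl , λ e → mk⇔ (onPath e) (onBranch e)
    where
    leaf-depth : suc (length w) ≡ h
    leaf-depth = ≤-antisym (recompute (length w <? h) q) (≮⇒≥ ¬q)
    W-edges : walkEdges G W ≡ []
    W-edges = path-from-t child≡t W uW
    onPath : ∀ e → e ∈ edge b w q′ ∷ walkEdges G W → lower e ⊑ b ∷ w × w ⊑ upper e
    onPath e (here refl) = ⊑-refl , ⊑-refl
    onPath e (there e∈W) with () ← subst (e ∈_) W-edges e∈W
    onBranch : ∀ e → lower e ⊑ b ∷ w × w ⊑ upper e → e ∈ edge b w q′ ∷ walkEdges G W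
    onBranch e (e⊑ , w⊑) with ⊑-edge-cases q′ ⊑-refl e e⊑ w⊑
    ... | inj₁ refl = here refl
    ... | inj₂ bw⊑ = ⊥-elim (lower⋢upper e (⊑-trans e⊑ bw⊑))
  ... | inj₁ (q₂ , child≡node)
    with ℓ , ℓ-length , bw⊑ℓ , W⇔ ← descend (b ∷ w) q₂ child≡node W uW (λ { _ refl v∈W → All.lookup w∉W v∈W refl })
    = ℓ , ℓ-length , ⊑-tail bw⊑ℓ , λ e → mk⇔ (onPath e) (onBranch e)
    where
    onPath : ∀ e → e ∈ edge b w q′ ∷ walkEdges G W → lower e ⊑ ℓ × w ⊑ upper e
    onPath e (here refl) = bw⊑ℓ , ⊑-refl
    onPath e (there e∈W) with e⊑ℓ , bw⊑ ← to (W⇔ e) e∈W = e⊑ℓ , ⊑-tail bw⊑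
    onBranch : ∀ e → lower e ⊑ ℓ × w ⊑ upper e → e ∈ edge b w q′ ∷ walkEdges G W
    onBranch e (e⊑ℓ , w⊑) with ⊑-edge-cases q′ bw⊑ℓ e e⊑ℓ w⊑
    ... | inj₁ refl = here refl
    ... | inj₂ bw⊑ = there (from (W⇔ e) (e⊑ℓ , bw⊑))

  path-branch : .(h≥1 : 1 ≤ h) (P : Path G (root h≥1) t) →
    ∃ λ ℓ → length ℓ ≡ h × (∀ e → e ∈ pathEdges G P ⇔ lower e ⊑ ℓ)
  path-branch h≥1 (W , uW) with ℓ , ℓ-length , _ , W⇔ ← descend [] h≥1 refl W uW (λ _ ())
    = ℓ , ℓ-length , λ e → mk⇔ (proj₁ ∘ to (W⇔ e)) (λ e⊑ℓ → from (W⇔ e) (e⊑ℓ , []⊑ (upper e)))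

  branch : (ℓ : List Bool) → .(length ℓ ≤ h) → List (TEdge h)
  branch [] _ = []
  branch (b ∷ w) q = edge b w q ∷ branch w (<⇒≤ q)

  length-branch : ∀ ℓ .q → length (branch ℓ q) ≡ length ℓ
  length-branch [] _ = refl
  length-branch (b ∷ w) q = cong suc (length-branch w (<⇒≤ q))

  ∈-branch⇔ : ∀ ℓ .q e → e ∈ branch ℓ q ⇔ lower e ⊑ ℓ
  ∈-branch⇔ ℓ q e = mk⇔ (∈⇒⊑ ℓ q) (⊑⇒∈ ℓ q e)
    where
    ∈⇒⊑ : ∀ ℓ .q → e ∈ branch ℓ q → lower e ⊑ ℓ
    ∈⇒⊑ (b ∷ w) q (here refl) = ⊑-refl
    ∈⇒⊑ (b ∷ w) q (there e∈) = ⊑-step (∈⇒⊑ w (<⇒≤ q) e∈)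
    ⊑⇒∈ : ∀ ℓ .q e → lower e ⊑ ℓ → e ∈ branch ℓ q
    ⊑⇒∈ (b ∷ w) q (edge b w _) ⊑-refl = here refl
    ⊑⇒∈ (b ∷ w) q e (⊑-step e⊑w) = there (⊑⇒∈ w (<⇒≤ q) e e⊑w)

  branch-unique : ∀ ℓ .q → Unique (branch ℓ q)
  branch-unique [] _ = []
  branch-unique (b ∷ w) q =
    All.tabulate (λ {e} e∈ e≡ → ∷⋢ (subst (λ e → lower e ⊑ w) (sym e≡) (to (∈-branch⇔ w _ e) e∈)))
    ∷ branch-unique w (<⇒≤ q)

  branch-saturation : ∀ {ℓ} (L : List (TEdge h)) → length ℓ ≡ h → length L ≤ h →
    (∀ e → lower e ⊑ ℓ → e ∈ L) → length L ≡ h × (∀ e → e ∈ L → lower e ⊑ ℓ)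
  branch-saturation {ℓ} L ℓ-length |L|≤h branch⊆L = ≤-antisym |L|≤h h≤|L| , on-branch
    where
    q : length ℓ ≤ h
    q = ≤-reflexive ℓ-length
    length-branch-ℓ : length (branch ℓ q) ≡ h
    length-branch-ℓ = trans (length-branch ℓ q) ℓ-length
    ∈branch⇒∈L : ∀ {e} → e ∈ branch ℓ q → e ∈ L
    ∈branch⇒∈L {e} = branch⊆L e ∘ to (∈-branch⇔ ℓ q e)
    h≤|L| : h ≤ length L
    h≤|L| = subst (_≤ length L) length-branch-ℓ (Unique-⊆⇒length≤ (branch-unique ℓ q) ∈branch⇒∈L)
    on-branch : ∀ e → e ∈ L → lower e ⊑ ℓ
    on-branch e e∈L with lower e ⊑? ℓ
    ... | yes e⊑ℓ = e⊑ℓ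
    ... | no e⋢ℓ = ⊥-elim (<-irrefl refl (≤-trans h<|L| |L|≤h))
      where
      e∉branch : All (e ≢_) (branch ℓ q)
      e∉branch = All.tabulate λ {e′} e′∈ e≡e′ → e⋢ℓ (subst (λ x → lower x ⊑ ℓ) (sym e≡e′) (to (∈-branch⇔ ℓ q e′) e′∈))
      h<|L| : h < length L
      h<|L| = subst (_≤ length L) (cong suc length-branch-ℓ)
        (Unique-⊆⇒length≤ (e∉branch ∷ branch-unique ℓ q) λ { (here refl) → e∈L ; (there e′∈) → ∈branch⇒∈L e′∈ })

module Leaves {h p : ℕ} (leaf : Fin p → List Bool) (leaf-length : ∀ i → length (leaf i) ≡ h) where

  leavesBelow : List Bool → ℕ
  leavesBelow v = count (λ i → v ⊑? leaf i)

  SharedBy : TEdge h → Set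
  SharedBy e = ∃₂ λ i j → ¬ i ≡ j × lower e ⊑ leaf i × lower e ⊑ leaf j

  leavesBelow-root : leavesBelow [] ≡ p
  leavesBelow-root = count-universal _ (λ i → []⊑ (leaf i))

  leavesBelow-children : ∀ v → length v < h → leavesBelow v ≡ leavesBelow (false ∷ v) + leavesBelow (true ∷ v)
  leavesBelow-children v v<h = trans
    (count-cong _ (λ i → (false ∷ v) ⊑? leaf i ⊎-dec (true ∷ v) ⊑? leaf i) (λ i → mk⇔ (child i) parent))
    (count-⊎ (λ i → (false ∷ v) ⊑? leaf i) (λ i → (true ∷ v) ⊑? leaf i) λ i f⊑ t⊑ → case ⊑-functional f⊑ t⊑ refl of λ ())
    where
    child : ∀ i → v ⊑ leaf i → false ∷ v ⊑ leaf i ⊎ true ∷ v ⊑ leaf i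
    child i v⊑ with ⊑-proper v⊑
    ... | inj₁ leaf≡v = ⊥-elim (<-irrefl (trans (sym (cong length leaf≡v)) (leaf-length i)) v<h)
    ... | inj₂ (false , f⊑) = inj₁ f⊑
    ... | inj₂ (true , t⊑) = inj₂ t⊑
    parent : ∀ {i} → false ∷ v ⊑ leaf i ⊎ true ∷ v ⊑ leaf i → v ⊑ leaf i
    parent (inj₁ f⊑) = ⊑-tail f⊑
    parent (inj₂ t⊑) = ⊑-tail t⊑

  SharedIn : List Bool → List (TEdge h) → Set
  SharedIn v U = Unique U × All (λ e → SharedBy e × v ⊑ lower e) U

  SharedIn-children : ∀ {v U₀ U₁} → SharedIn (false ∷ v) U₀ → SharedIn (true ∷ v) U₁ →
    Unique (U₀ ++ U₁) × All (λ e → SharedBy e × v ⊑ upper e) (U₀ ++ U₁)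
  SharedIn-children {v} (u₀ , a₀) (u₁ , a₁) =
    ++⁺ u₀ u₁ (λ (e∈₀ , e∈₁) → case ⊑-functional (proj₂ (All.lookup a₀ e∈₀)) (proj₂ (All.lookup a₁ e∈₁)) refl of λ ())
    , All-++⁺ (All.map (map₂ (∷⊑lower⇒⊑upper _)) a₀) (All.map (map₂ (∷⊑lower⇒⊑upper _)) a₁)

  grow : ∀ {c w U₀ U₁} .(q : length w < h) → SharedBy (edge c w q) →
    SharedIn (false ∷ c ∷ w) U₀ → SharedIn (true ∷ c ∷ w) U₁ → SharedIn (c ∷ w) (edge c w q ∷ U₀ ++ U₁)
  grow {c} {w} q shared s₀ s₁ with u , a ← SharedIn-children s₀ s₁ =
    All.map (λ (_ , cw⊑) e≡ → ∷⋢ (subst (λ e → c ∷ w ⊑ upper e) (sym e≡) cw⊑)) a ∷ u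
    , (shared , ⊑-refl) ∷ All.map (λ {e} → map₂ (λ cw⊑ → ⊑-trans cw⊑ (upper⊑lower e))) a

  module _ (leaf-injective : ∀ {i j} → leaf i ≡ leaf j → i ≡ j) where

    subtree-bound : ∀ n c w → length (c ∷ w) + n ≡ h →
      ∃ λ U → SharedIn (c ∷ w) U × leavesBelow (c ∷ w) ≤ suc (length U)
    subtree-bound n c w depth with 2 ≤? leavesBelow (c ∷ w)
    ... | no ¬two = [] , ([] , []) , ≤-pred (≰⇒> ¬two)
    ... | yes two with i , j , i≢j , i⊑ , j⊑ ← count-two-witnesses (λ i → (c ∷ w) ⊑? leaf i) two | n
    ...   | zero = ⊥-elim (i≢j (leaf-injective (trans (sym (at-leaf i i⊑)) (at-leaf j j⊑))))
      where
      at-leaf : ∀ i → c ∷ w ⊑ leaf i → c ∷ w ≡ leaf i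
      at-leaf i cw⊑ = ⊑-length-≡ cw⊑ (trans (trans (sym (+-identityʳ _)) depth) (sym (leaf-length i)))
    ...   | suc m
      with U₀ , s₀ , bound₀ ← subtree-bound m false (c ∷ w) (trans (sym (+-suc _ m)) depth)
         | U₁ , s₁ , bound₁ ← subtree-bound m true (c ∷ w) (trans (sym (+-suc _ m)) depth)
      = edge c w q ∷ U₀ ++ U₁ , grow q (i , j , i≢j , i⊑ , j⊑) s₀ s₁ , (begin
        leavesBelow (c ∷ w)                                      ≡⟨ leavesBelow-children (c ∷ w) cw<h ⟩
        leavesBelow (false ∷ c ∷ w) + leavesBelow (true ∷ c ∷ w) ≤⟨ +-mono-≤ bound₀ bound₁ ⟩
        suc (length U₀) + suc (length U₁)                        ≡⟨ 2+length-++ U₀ U₁ ⟩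
        suc (length (edge c w q ∷ U₀ ++ U₁))                     ∎)
      where
      open ≤-Reasoning
      cw<h : length (c ∷ w) < h
      cw<h = subst (length (c ∷ w) <_) depth (m<m+n _ (s≤s z≤n))
      q : length w < h
      q = <⇒≤ cw<h

    distinct-leaves-bound : 1 ≤ h → ∀ (L : List (TEdge h)) → (∀ e → SharedBy e → e ∈ L) → p ≤ 2 + length L
    distinct-leaves-bound h≥1 L shared∈L
      with U₀ , (u₀ , a₀) , bound₀ ← subtree-bound (h ∸ 1) false [] (m+[n∸m]≡n h≥1)
         | U₁ , (u₁ , a₁) , bound₁ ← subtree-bound (h ∸ 1) true [] (m+[n∸m]≡n h≥1)
      with u , a ← SharedIn-children {U₀ = U₀} {U₁} (u₀ , a₀) (u₁ , a₁) = begin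
      p                                                  ≡⟨ leavesBelow-root ⟨
      leavesBelow []                                     ≡⟨ leavesBelow-children [] h≥1 ⟩
      leavesBelow (false ∷ []) + leavesBelow (true ∷ []) ≤⟨ +-mono-≤ bound₀ bound₁ ⟩
      suc (length U₀) + suc (length U₁)                  ≡⟨ 2+length-++ U₀ U₁ ⟩
      2 + length (U₀ ++ U₁)                              ≤⟨ +-monoʳ-≤ 2 (Unique-⊆⇒length≤ u U⊆L) ⟩
      2 + length L                                       ∎
      where
      open ≤-Reasoning
      U⊆L : ∀ {e} → e ∈ U₀ ++ U₁ → e ∈ L
      U⊆L e∈ = shared∈L _ (proj₁ (All.lookup a e∈))

injective-or-collision : ∀ {p} {A : Set} → DecidableEquality A → (f : Fin p → A) →
  (∀ {i j} → f i ≡ f j → i ≡ j) ⊎ ∃₂ λ i j → i ≢ j × f i ≡ f j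
injective-or-collision _≟_ f with any? (λ i → any? (λ j → ¬? (i ≟ᶠ j) ×-dec f i ≟ f j))
... | yes (i , j , collision) = inj₂ (i , j , collision)
... | no ¬collision = inj₁ λ {i} {j} fi≡fj → decidable-stable (i ≟ᶠ j) λ i≢j → ¬collision (i , j , i≢j , fi≡fj)

module PathFamily {h p : ℕ} .(h≥1 : 1 ≤ h) (P : Fin p → Path (TreeLeaves h) (root h≥1) t) where

  leaf : Fin p → List Bool
  leaf i = proj₁ (path-branch h≥1 (P i))

  leaf-length : ∀ i → length (leaf i) ≡ h
  leaf-length i = proj₁ (proj₂ (path-branch h≥1 (P i)))

  open Leaves leaf leaf-length public

  Shared⇔SharedBy : ∀ e → Shared (TreeLeaves h) P e ⇔ SharedBy e
  Shared⇔SharedBy e = mk⇔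
    (λ (i , j , i≢j , e∈Pᵢ , e∈Pⱼ) → i , j , i≢j , to (on-path i) e∈Pᵢ , to (on-path j) e∈Pⱼ)
    (λ (i , j , i≢j , e⊑ᵢ , e⊑ⱼ) → i , j , i≢j , from (on-path i) e⊑ᵢ , from (on-path j) e⊑ⱼ)
    where
    on-path : ∀ i → e ∈ pathEdges (TreeLeaves h) (P i) ⇔ lower e ⊑ leaf i
    on-path i = proj₂ (proj₂ (path-branch h≥1 (P i))) e

lemma4 : (h : ℕ) (h≥1 : 1 ≤ h) (p k : ℕ) → p ≥ h + 3 → k ≤ h →
    (P : Fin p → Path (TreeLeaves h) (root h≥1) t) →
    AtMostShared (TreeLeaves h) P k →
    (k ≡ h) × (∃ λ (ℓ : List Bool) → (length ℓ ≡ h) ×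
      (∀ (e : TEdge h) → Shared (TreeLeaves h) P e ⇔ OnBranch ℓ e))
lemma4 h h≥1 p k p≥h+3 k≤h P (L , |L|≤k , shared⇒∈L) =
  case injective-or-collision (≡-dec _≟ᴮ_) leaf of λ where
    (inj₁ leaf-injective) → ⊥-elim (<-irrefl refl (begin
      3 + h        ≡⟨ +-comm 3 h ⟩
      h + 3        ≤⟨ p≥h+3 ⟩
      p            ≤⟨ distinct-leaves-bound leaf-injective h≥1 L sharedBy⇒∈L ⟩
      2 + length L ≤⟨ +-monoʳ-≤ 2 |L|≤h ⟩
      2 + h        ∎))
    (inj₂ (i , j , i≢j , leafᵢ≡leafⱼ)) →
      let on⇒sharedBy : ∀ e → lower e ⊑ leaf i → SharedBy e
          on⇒sharedBy e e⊑ = i , j , i≢j , e⊑ , subst (lower e ⊑_) leafᵢ≡leafⱼ e⊑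
          (|L|≡h , L⊆branch) = branch-saturation L (leaf-length i) |L|≤h (λ e → sharedBy⇒∈L e ∘ on⇒sharedBy e)
      in ≤-antisym k≤h (subst (_≤ k) |L|≡h |L|≤k) , leaf i , leaf-length i , λ e → mk⇔
           (from (OnBranch⇔⊑ (leaf i) e) ∘ L⊆branch e ∘ shared⇒∈L e)
           (from (Shared⇔SharedBy e) ∘ on⇒sharedBy e ∘ to (OnBranch⇔⊑ (leaf i) e))
  where
  open PathFamily h≥1 P
  open ≤-Reasoning
  |L|≤h : length L ≤ h
  |L|≤h = ≤-trans |L|≤k k≤h
  sharedBy⇒∈L : ∀ e → SharedBy e → e ∈ L
  sharedBy⇒∈L e = shared⇒∈L e ∘ from (Shared⇔SharedBy e)
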